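{- Let $L$ be any of the fifteen logics of the modal cube and $\mathcal M_L$ its Nmatrix. If $v$ is a partial level-valuation (for $L$) whose domain is all of $\mathrm{For}$, then $v\in L_n(\mathcal M_L)$ for every $n\ge0$.
   Context: Syntax and logics. Formulas: $\alpha ::= p \mid \bot \mid \alpha\to\alpha \mid \Box\alpha$; $\mathrm{For}$ is the set of formulas; $\neg\alpha:=\alpha\to\bot$, $\Diamond\alpha:=\neg\Box\neg\alpha$. $\mathbf K$: classical propositional axioms, (k) $\Box(\alpha\to\beta)\to(\Box\alpha\to\Box\beta)$, modus ponens, necessitation. Axiom schemes (D) $\Box\alpha\to\Diamond\alpha$, (T) $\Box\alpha\to\alpha$, (B) $\alpha\to\Box\Diamond\alpha$, (4) $\Box\alpha\to\Box\Box\alpha$, (5) $\Diamond\alpha\to\Box\Diamond\alpha$. The modal cube: $\mathbf K,\mathbf{KB},\mathbf{K4},\mathbf{K5},\mathbf{K45},\mathbf{KD},\mathbf{KDB},\mathbf{KD4},\mathbf{KD5},\mathbf{KD45},\mathbf{KT},\mathbf{KTB},\mathbf{S4}=\mathbf{KT4},\mathbf{S5}=\mathbf{KTB45},\mathbf{KB5}=\mathbf{KB45}$. Truth values $\mathbf{F},\mathbf{f},\mathbf{f}_2,\mathbf{f}_3,\mathbf{t}_3,\mathbf{t}_2,\mathbf{t},\mathbf{T}$. Distinguished sets: $\mathcal D=\{\mathbf T,\mathbf t,\mathbf t_2,\mathbf t_3\}$ (designated), $N=\{\mathbf T,\mathbf t_2,\mathbf f_3,\mathbf f_2\}$, $I=\{\mathbf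 F,\mathbf f_2,\mathbf t_3,\mathbf t_2\}$, $P=\{\mathbf T,\mathbf t,\mathbf f_3,\mathbf f\}$, $PN=\{\mathbf F,\mathbf f,\mathbf t_3,\mathbf t\}$. Nmatrix $\mathcal M_L$. Values $V(L)$: all eight values for $\mathbf K,\mathbf{KB},\mathbf{K4},\mathbf{K5},\mathbf{K45}$; $\{\mathbf F,\mathbf f,\mathbf f_2,\mathbf t_2,\mathbf t,\mathbf T\}$ for $\mathbf{KB5}$; $\{\mathbf F,\mathbf f,\mathbf f_3,\mathbf t_3,\mathbf t,\mathbf T\}$ for $\mathbf{KD},\mathbf{KDB},\mathbf{KD4},\mathbf{KD5},\mathbf{KD45}$; $\{\mathbf F,\mathbf f,\mathbf t,\mathbf T\}$ for $\mathbf{KT},\mathbf{KTB},\mathbf{S4},\mathbf{S5}$. $\tilde\bot=\{\mathbf F,\mathbf f_2\}$. $\tilde\to(x,y)$, restricted to arguments in $V(L)$, listed for $y=\mathbf F,\mathbf f,\mathbf f_2,\mathbf f_3,\mathbf t_3,\mathbf t_2,\mathbf t,\mathbf T$: $x=\mathbf F$: $\{\mathbf T\}$ for all $y$; $x=\mathbf f$: $\{\mathbf t\},\{\mathbf T,\mathbf t\},\{\mathbf t_2\},\{\mathbf T\},\{\mathbf t\},\{\mathbf T\},\{\mathbf T,\mathbf t\},\{\mathbf T\}$; $x=\mathbf f_2$ and $x=\mathbf f_3$: $\{\mathbf t_3\},\{\mathbf t\},\{\mathbf t_2\},\{\mathbf T\},\{\mathbf t_3\},\{\mathbf t_2\},\{\mathbf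 t\},\{\mathbf T\}$; $x=\mathbf t_3$: $\{\mathbf f_3\}$ for $y\in\{\mathbf F,\mathbf f,\mathbf f_2,\mathbf f_3\}$, $\{\mathbf T\}$ otherwise; $x=\mathbf t_2$: $\{\mathbf F\},\{\mathbf f\},\{\mathbf f_2\},\{\mathbf f_3\},\{\mathbf t_3\},\{\mathbf t_2\},\{\mathbf t_3\},\{\mathbf T\}$; $x=\mathbf t$: $\{\mathbf f\},\{\mathbf f,\mathbf f_3\},\{\mathbf f_3\},\{\mathbf f_3\},\{\mathbf t\},\{\mathbf T\},\{\mathbf T,\mathbf t\},\{\mathbf T\}$; $x=\mathbf T$: $\{\mathbf F\},\{\mathbf f\},\{\mathbf f_2\},\{\mathbf f_3\},\{\mathbf t_3\},\{\mathbf t_2\},\{\mathbf t\},\{\mathbf T\}$. $\tilde\Box$ (argument $\mapsto$ output): $\mathbf K$: $\mathbf F,\mathbf f,\mathbf t_3,\mathbf t\mapsto\{\mathbf F,\mathbf f,\mathbf f_3\}$; $\mathbf f_2,\mathbf t_2\mapsto\{\mathbf t_2\}$; $\mathbf f_3,\mathbf T\mapsto\{\mathbf T,\mathbf t,\mathbf t_3\}$. $\mathbf{KB}$: $\mathbf F,\mathbf f\mapsto\{\mathbf F\}$; $\mathbf f_2,\mathbf t_2\mapsto\{\mathbf t_2\}$; $\mathbf f_3\mapsto\{\mathbf t_3\}$; $\mathbf t_3,\mathbf t\mapsto\{\mathbf F,\mathbf f,\mathbf f_3\}$; $\mathbf T\mapsto\{\mathbf T,\mathbf t,\mathbf t_3\}$.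 $\mathbf{K4}$: $\mathbf F,\mathbf f,\mathbf t_3,\mathbf t\mapsto\{\mathbf F,\mathbf f,\mathbf f_3\}$; $\mathbf f_2,\mathbf t_2\mapsto\{\mathbf t_2\}$; $\mathbf f_3,\mathbf T\mapsto\{\mathbf T\}$. $\mathbf{K5}$: $\mathbf F,\mathbf f,\mathbf t_3,\mathbf t\mapsto\{\mathbf F\}$; $\mathbf f_2,\mathbf t_2\mapsto\{\mathbf t_2\}$; $\mathbf f_3,\mathbf T\mapsto\{\mathbf T,\mathbf t_3\}$. $\mathbf{K45}$: $\mathbf F,\mathbf f,\mathbf t_3,\mathbf t\mapsto\{\mathbf F\}$; $\mathbf f_2,\mathbf t_2\mapsto\{\mathbf t_2\}$; $\mathbf f_3,\mathbf T\mapsto\{\mathbf T\}$. $\mathbf{KB5}$: $\mathbf F,\mathbf f,\mathbf t\mapsto\{\mathbf F\}$; $\mathbf f_2,\mathbf t_2\mapsto\{\mathbf t_2\}$; $\mathbf T\mapsto\{\mathbf T\}$. $\mathbf{KD}$: $\mathbf F,\mathbf f,\mathbf t_3,\mathbf t\mapsto\{\mathbf F,\mathbf f,\mathbf f_3\}$; $\mathbf f_3,\mathbf T\mapsto\{\mathbf T,\mathbf t,\mathbf t_3\}$. $\mathbf{KDB}$: $\mathbf F,\mathbf f\mapsto\{\mathbf F\}$; $\mathbf f_3\mapsto\{\mathbf t_3\}$; $\mathbf t_3,\mathbf t\mapsto\{\mathbf F,\mathbf f,\mathbf f_3\}$; $\mathbf T\mapsto\{\mathbf T,\mathbf t,\mathbf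 t_3\}$. $\mathbf{KD4}$: $\mathbf F,\mathbf t_3\mapsto\{\mathbf F\}$; $\mathbf f,\mathbf t\mapsto\{\mathbf F,\mathbf f,\mathbf f_3\}$; $\mathbf f_3,\mathbf T\mapsto\{\mathbf T\}$. $\mathbf{KD5}$: $\mathbf F,\mathbf f,\mathbf t_3,\mathbf t\mapsto\{\mathbf F\}$; $\mathbf f_3,\mathbf T\mapsto\{\mathbf T,\mathbf t_3\}$. $\mathbf{KD45}$: $\mathbf F,\mathbf f,\mathbf t_3,\mathbf t\mapsto\{\mathbf F\}$; $\mathbf f_3,\mathbf T\mapsto\{\mathbf T\}$. $\mathbf{KT}$: $\mathbf F\mapsto\{\mathbf F\}$; $\mathbf f,\mathbf t\mapsto\{\mathbf F,\mathbf f\}$; $\mathbf T\mapsto\{\mathbf T,\mathbf t\}$. $\mathbf{KTB}$: $\mathbf F,\mathbf f\mapsto\{\mathbf F\}$; $\mathbf t\mapsto\{\mathbf F,\mathbf f\}$; $\mathbf T\mapsto\{\mathbf T,\mathbf t\}$. $\mathbf{S4}$: $\mathbf F\mapsto\{\mathbf F\}$; $\mathbf f,\mathbf t\mapsto\{\mathbf F,\mathbf f\}$; $\mathbf T\mapsto\{\mathbf T\}$. $\mathbf{S5}$: $\mathbf F,\mathbf f,\mathbf t\mapsto\{\mathbf F\}$; $\mathbf T\mapsto\{\mathbf T\}$. Partial valuations: for $\Lambda$ closed under subformulas, $[\Lambda\to V]_{\mathcal M_L}$ is the set of maps $v:\Lambda\to V(L)$ with $v(\bot)\in\tilde\bot$,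 $v(\beta\to\gamma)\in\tilde\to(v(\beta),v(\gamma))$, $v(\Box\beta)\in\tilde\Box(v(\beta))$ whenever these formulas lie in $\Lambda$. A valuation is such a map with $\Lambda=\mathrm{For}$; $\mathrm{Val}(\mathcal M_L)$ is the set of valuations. Level valuations: $L_0(\mathcal M_L)$ is the set of $v\in\mathrm{Val}(\mathcal M_L)$ such that, if $v(\beta)\in\{\mathbf f_2,\mathbf t_2\}$ for some $\beta$, then $v(\gamma)\in\{\mathbf f_2,\mathbf t_2\}$ for all $\gamma$. $L_{n+1}(\mathcal M_L)=\{v\in L_n(\mathcal M_L)\mid$ for all $\beta$, if $w(\beta)\in\mathcal D$ for every $w\in L_n(\mathcal M_L)$, then $v(\beta)\in\{\mathbf T,\mathbf t_2\}\}$. Models: a pre-model on $\Lambda$ is a pair $\langle\Pi,R\rangle$ with $\Pi\subseteq[\Lambda\to V]_{\mathcal M_L}$ and $R\subseteq\Pi\times\Pi$ such that for all $v\in\Pi$, $\beta\in\Lambda$: if $v(\beta)\in P$ there is $w\in\Pi$ with $vRw$ and $w(\beta)\in\mathcal D$; if $v(\beta)\in PN$ there is $w\in\Pi$ with $vRw$ and $w(\beta)\notin\mathcal D$. A $\mathbf K$-model is a pre-model such that whenever $vRw$: $v(\beta)\in N\Rightarrow w(\beta)\in\mathcal D$ and $v(\beta)\in I\Rightarrow w(\beta)\notin\mathcal D$. An $L$-model is a $\mathbf K$-model satisfying, for each axiom scheme among (T),(D),(B),(4),(5) that holds in $L$, the following conditions for all $v,w,w'\in\Pi$, $\beta\in\Lambda$: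 (T): $v(\beta)\in N\Rightarrow v(\beta)\in\mathcal D$, and $v(\beta)\in I\Rightarrow v(\beta)\notin\mathcal D$; (D): $v(\beta)\in N\Rightarrow v(\beta)\in P$, and $v(\beta)\in I\Rightarrow v(\beta)\in PN$; (B): if $vRw$, then $v(\beta)\in\mathcal D\Rightarrow w(\beta)\in P$ and $v(\beta)\notin\mathcal D\Rightarrow w(\beta)\in PN$; (4): if $vRw$, then $v(\beta)\in N\Rightarrow w(\beta)\in N$ and $v(\beta)\in I\Rightarrow w(\beta)\in I$; (5): if $vRw$, then $v(\beta)\in P\Rightarrow w(\beta)\in P$ and $v(\beta)\in PN\Rightarrow w(\beta)\in PN$; moreover if $v(\beta),w(\beta)\in N$, $vRw$ and ($vRw'$ or $wRw'$) then $w'(\beta)\in N$, and likewise with $I$ in place of $N$. A partial valuation $v$ is a partial level-valuation (for $L$) if $v\in\Pi$ for some $L$-model $\langle\Pi,R\rangle$. -}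

module Defs where

open import Data.Nat using (ℕ; zero; suc)
open import Data.Bool using (Bool; true; false; T)
open import Data.List using (List; []; _∷_)
open import Data.List.Membership.Propositional using (_∈_)
open import Data.Product using (Σ; _×_; _,_; ∃)
open import Data.Sum using (_⊎_)
open import Relation.Nullary using (¬_)

data For : Set where
  var : ℕ → For
  ⊥′  : For
  _⇒_ : For → For → For
  □_  : For → For

data TV : Set where
  FF ff f₂ f₃ t₃ t₂ tt TT : TV

isD : TV → Bool
isD TT = true
isD tt = true
isD t₂ = true
isD t₃ = true
isD _  = false

isN : TV → Bool
isN TT = true
isN t₂ = true
isN f₃ = true
isN f₂ = true
isN _  = false

isI : TV → Bool
isI FF = true
isI f₂ = true
isI t₃ = true
isI t₂ = true
isI _  = false

isP : TV → Bool
isP TT = true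
isP tt = true
isP f₃ = true
isP ff = true
isP _  = false

isPN : TV → Bool
isPN FF = true
isPN ff = true
isPN t₃ = true
isPN tt = true
isPN _  = false

Des Nec Imp Pos PNe : TV → Set
Des x = T (isD x)
Nec x = T (isN x)
Imp x = T (isI x)
Pos x = T (isP x)
PNe x = T (isPN x)

TopVal : TV → Set
TopVal x = x ∈ (TT ∷ t₂ ∷ [])

TwoVal : TV → Set
TwoVal x = x ∈ (f₂ ∷ t₂ ∷ [])

data Logic : Set where
  K KB K4 K5 K45 KB5 KD KDB KD4 KD5 KD45 KT KTB S4 S5 : Logic

data Ax : Set where
  axT axD axB ax4 ax5 : Ax

holds : Logic → Ax → Bool
holds K   _   = false
holds KB  axB = true
holds KB  _   = false
holds K4  ax4 = true
holds K4  _   = false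
holds K5  ax5 = true
holds K5  _   = false
holds K45 ax4 = true
holds K45 ax5 = true
holds K45 _   = false
holds KB5 axB = true      -- KB5 = KB45
holds KB5 ax4 = true
holds KB5 ax5 = true
holds KB5 _   = false
holds KD  axD = true
holds KD  _   = false
holds KDB axD = true
holds KDB axB = true
holds KDB _   = false
holds KD4 axD = true
holds KD4 ax4 = true
holds KD4 _   = false
holds KD5 axD = true
holds KD5 ax5 = true
holds KD5 _   = false
holds KD45 axD = true
holds KD45 ax4 = true
holds KD45 ax5 = true
holds KD45 _   = false
holds KT  axT = true
holds KT  axD = true      -- T ⊢ D
holds KT  _   = false
holds KTB axT = true
holds KTB axD = true
holds KTB axB = true
holds KTB _   = false
holds S4  axT = true
holds S4  axD = true
holds S4  ax4 = true
holds S4  _   = false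
holds S5  _   = true      -- S5 = KTB45, D and 5 hold as well

all8 six-KB5 six-KD four-KT : List TV
all8    = FF ∷ ff ∷ f₂ ∷ f₃ ∷ t₃ ∷ t₂ ∷ tt ∷ TT ∷ []
six-KB5 = FF ∷ ff ∷ f₂ ∷ t₂ ∷ tt ∷ TT ∷ []
six-KD  = FF ∷ ff ∷ f₃ ∷ t₃ ∷ tt ∷ TT ∷ []
four-KT = FF ∷ ff ∷ tt ∷ TT ∷ []

Vals : Logic → List TV
Vals K    = all8
Vals KB   = all8
Vals K4   = all8
Vals K5   = all8
Vals K45  = all8
Vals KB5  = six-KB5
Vals KD   = six-KD
Vals KDB  = six-KD
Vals KD4  = six-KD
Vals KD5  = six-KD
Vals KD45 = six-KD
Vals KT   = four-KT
Vals KTB  = four-KT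
Vals S4   = four-KT
Vals S5   = four-KT

bot~ : List TV
bot~ = FF ∷ f₂ ∷ []

arr : TV → TV → List TV
arr FF _  = TT ∷ []
arr ff FF = tt ∷ []
arr ff ff = TT ∷ tt ∷ []
arr ff f₂ = t₂ ∷ []
arr ff f₃ = TT ∷ []
arr ff t₃ = tt ∷ []
arr ff t₂ = TT ∷ []
arr ff tt = TT ∷ tt ∷ []
arr ff TT = TT ∷ []
arr f₂ FF = t₃ ∷ []
arr f₂ ff = tt ∷ []
arr f₂ f₂ = t₂ ∷ []
arr f₂ f₃ = TT ∷ []
arr f₂ t₃ = t₃ ∷ []
arr f₂ t₂ = t₂ ∷ []
arr f₂ tt = tt ∷ []
arr f₂ TT = TT ∷ []
arr f₃ FF = t₃ ∷ []
arr f₃ ff = tt ∷ []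
arr f₃ f₂ = t₂ ∷ []
arr f₃ f₃ = TT ∷ []
arr f₃ t₃ = t₃ ∷ []
arr f₃ t₂ = t₂ ∷ []
arr f₃ tt = tt ∷ []
arr f₃ TT = TT ∷ []
arr t₃ FF = f₃ ∷ []
arr t₃ ff = f₃ ∷ []
arr t₃ f₂ = f₃ ∷ []
arr t₃ f₃ = f₃ ∷ []
arr t₃ _  = TT ∷ []
arr t₂ FF = FF ∷ []
arr t₂ ff = ff ∷ []
arr t₂ f₂ = f₂ ∷ []
arr t₂ f₃ = f₃ ∷ []
arr t₂ t₃ = t₃ ∷ []
arr t₂ t₂ = t₂ ∷ []
arr t₂ tt = t₃ ∷ []
arr t₂ TT = TT ∷ []
arr tt FF = ff ∷ []
arr tt ff = ff ∷ f₃ ∷ []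
arr tt f₂ = f₃ ∷ []
arr tt f₃ = f₃ ∷ []
arr tt t₃ = tt ∷ []
arr tt t₂ = TT ∷ []
arr tt tt = TT ∷ tt ∷ []
arr tt TT = TT ∷ []
arr TT y  = y ∷ []

-- interpretation of □ (arguments outside V(L) never occur; mapped to ∅)
box : Logic → TV → List TV
box K FF = FF ∷ ff ∷ f₃ ∷ []
box K ff = FF ∷ ff ∷ f₃ ∷ []
box K t₃ = FF ∷ ff ∷ f₃ ∷ []
box K tt = FF ∷ ff ∷ f₃ ∷ []
box K f₂ = t₂ ∷ []
box K t₂ = t₂ ∷ []
box K f₃ = TT ∷ tt ∷ t₃ ∷ []
box K TT = TT ∷ tt ∷ t₃ ∷ []
box KB FF = FF ∷ []
box KB ff = FF ∷ []
box KB f₂ = t₂ ∷ []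
box KB t₂ = t₂ ∷ []
box KB f₃ = t₃ ∷ []
box KB t₃ = FF ∷ ff ∷ f₃ ∷ []
box KB tt = FF ∷ ff ∷ f₃ ∷ []
box KB TT = TT ∷ tt ∷ t₃ ∷ []
box K4 FF = FF ∷ ff ∷ f₃ ∷ []
box K4 ff = FF ∷ ff ∷ f₃ ∷ []
box K4 t₃ = FF ∷ ff ∷ f₃ ∷ []
box K4 tt = FF ∷ ff ∷ f₃ ∷ []
box K4 f₂ = t₂ ∷ []
box K4 t₂ = t₂ ∷ []
box K4 f₃ = TT ∷ []
box K4 TT = TT ∷ []
box K5 FF = FF ∷ []
box K5 ff = FF ∷ []
box K5 t₃ = FF ∷ []
box K5 tt = FF ∷ []
box K5 f₂ = t₂ ∷ []
box K5 t₂ = t₂ ∷ []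
box K5 f₃ = TT ∷ t₃ ∷ []
box K5 TT = TT ∷ t₃ ∷ []
box K45 FF = FF ∷ []
box K45 ff = FF ∷ []
box K45 t₃ = FF ∷ []
box K45 tt = FF ∷ []
box K45 f₂ = t₂ ∷ []
box K45 t₂ = t₂ ∷ []
box K45 f₃ = TT ∷ []
box K45 TT = TT ∷ []
box KB5 FF = FF ∷ []
box KB5 ff = FF ∷ []
box KB5 tt = FF ∷ []
box KB5 f₂ = t₂ ∷ []
box KB5 t₂ = t₂ ∷ []
box KB5 TT = TT ∷ []
box KB5 _  = []
box KD FF = FF ∷ ff ∷ f₃ ∷ []
box KD ff = FF ∷ ff ∷ f₃ ∷ []
box KD t₃ = FF ∷ ff ∷ f₃ ∷ []
box KD tt = FF ∷ ff ∷ f₃ ∷ []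
box KD f₃ = TT ∷ tt ∷ t₃ ∷ []
box KD TT = TT ∷ tt ∷ t₃ ∷ []
box KD _  = []
box KDB FF = FF ∷ []
box KDB ff = FF ∷ []
box KDB f₃ = t₃ ∷ []
box KDB t₃ = FF ∷ ff ∷ f₃ ∷ []
box KDB tt = FF ∷ ff ∷ f₃ ∷ []
box KDB TT = TT ∷ tt ∷ t₃ ∷ []
box KDB _  = []
box KD4 FF = FF ∷ []
box KD4 t₃ = FF ∷ []
box KD4 ff = FF ∷ ff ∷ f₃ ∷ []
box KD4 tt = FF ∷ ff ∷ f₃ ∷ []
box KD4 f₃ = TT ∷ []
box KD4 TT = TT ∷ []
box KD4 _  = []
box KD5 FF = FF ∷ []
box KD5 ff = FF ∷ []
box KD5 t₃ = FF ∷ []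
box KD5 tt = FF ∷ []
box KD5 f₃ = TT ∷ t₃ ∷ []
box KD5 TT = TT ∷ t₃ ∷ []
box KD5 _  = []
box KD45 FF = FF ∷ []
box KD45 ff = FF ∷ []
box KD45 t₃ = FF ∷ []
box KD45 tt = FF ∷ []
box KD45 f₃ = TT ∷ []
box KD45 TT = TT ∷ []
box KD45 _  = []
box KT FF = FF ∷ []
box KT ff = FF ∷ ff ∷ []
box KT tt = FF ∷ ff ∷ []
box KT TT = TT ∷ tt ∷ []
box KT _  = []
box KTB FF = FF ∷ []
box KTB ff = FF ∷ []
box KTB tt = FF ∷ ff ∷ []
box KTB TT = TT ∷ tt ∷ []
box KTB _  = []
box S4 FF = FF ∷ []
box S4 ff = FF ∷ ff ∷ []
box S4 tt = FF ∷ ff ∷ []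
box S4 TT = TT ∷ []
box S4 _  = []
box S5 FF = FF ∷ []
box S5 ff = FF ∷ []
box S5 tt = FF ∷ []
box S5 TT = TT ∷ []
box S5 _  = []

-- Valuations of M_L (total maps For → V(L) respecting the Nmatrix);
-- this is also exactly a partial valuation with domain Λ = For.

record IsVal (L : Logic) (v : For → TV) : Set where
  field
    inV  : ∀ φ → v φ ∈ Vals L
    valB : v ⊥′ ∈ bot~
    valI : ∀ β γ → v (β ⇒ γ) ∈ arr (v β) (v γ)
    valN : ∀ β → v (□ β) ∈ box L (v β)

Lev : Logic → ℕ → (For → TV) → Set
Lev L zero v =
  IsVal L v × (∀ β γ → TwoVal (v β) → TwoVal (v γ))
Lev L (suc n) v =
  Lev L n v ×
  (∀ β → (∀ w → Lev L n w → Des (w β)) → TopVal (v β))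

-- L-models on Λ = For.  Π ⊆ [For → V]_{M_L} is a predicate on maps,
-- R ⊆ Π × Π a binary relation.

Val = For → TV

record Model (L : Logic) : Set₁ where
  field
    Π    : Val → Set
    R    : Val → Val → Set
    Π-val : ∀ v → Π v → IsVal L v
    R-dom : ∀ v w → R v w → Π v × Π w
    preP  : ∀ v β → Π v → Pos (v β) → Σ Val λ w → Π w × R v w × Des (w β)
    prePN : ∀ v β → Π v → PNe (v β) → Σ Val λ w → Π w × R v w × ¬ Des (w β)
    kN : ∀ v w β → R v w → Nec (v β) → Des (w β)
    kI : ∀ v w β → R v w → Imp (v β) → ¬ Des (w β)
    axiomT-N : T (holds L axT) → ∀ v β → Π v → Nec (v β) → Des (v β)
    axiomT-I : T (holds L axT) → ∀ v β → Π v → Imp (v β) → ¬ Des (v β)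
    axiomD-N : T (holds L axD) → ∀ v β → Π v → Nec (v β) → Pos (v β)
    axiomD-I : T (holds L axD) → ∀ v β → Π v → Imp (v β) → PNe (v β)
    axiomB-D  : T (holds L axB) → ∀ v w β → R v w → Des (v β) → Pos (w β)
    axiomB-ND : T (holds L axB) → ∀ v w β → R v w → ¬ Des (v β) → PNe (w β)
    axiom4-N : T (holds L ax4) → ∀ v w β → R v w → Nec (v β) → Nec (w β)
    axiom4-I : T (holds L ax4) → ∀ v w β → R v w → Imp (v β) → Imp (w β)
    axiom5-P  : T (holds L ax5) → ∀ v w β → R v w → Pos (v β) → Pos (w β)
    axiom5-PN : T (holds L ax5) → ∀ v w β → R v w → PNe (v β) → PNe (w β)
    axiom5-N  : T (holds L ax5) → ∀ v w w′ β → Nec (v β) → Nec (w β) →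
                R v w → (R v w′ ⊎ R w w′) → Nec (w′ β)
    axiom5-I  : T (holds L ax5) → ∀ v w w′ β → Imp (v β) → Imp (w β) →
                R v w → (R v w′ ⊎ R w w′) → Imp (w′ β)

PartialLevelVal : Logic → Val → Set₁
PartialLevelVal L v = Σ (Model L) λ M → Model.Π M v

{-# OPTIONS --safe #-}
-- A value in {f₂, t₂} lies in both N and I, so a world taking it can have no
-- successor, whereas every other value lies in P ∪ PN and demands one: hence
-- a world with one such value takes such values everywhere, which is level 0.
-- For level n + 1, by induction every world of the model is in L_n, so a
-- formula designated throughout L_n is designated at the world and at all its
-- successors; but a designated value outside {T, t₂} lies in PN and would
-- demand a successor refuting it.
module Submission where

open import Defs
open import Data.Nat using (ℕ; zero; suc)
open import Data.Sum using (_⊎_; inj₁; inj₂)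
open import Data.Product using (_×_; _,_)
open import Data.Empty using (⊥-elim)
open import Data.Unit using (tt)
open import Relation.Nullary using (¬_)
open import Data.List.Relation.Unary.Any using (here; there)
open import Relation.Binary.PropositionalEquality using (refl)

twoVal⇒Nec×Imp : ∀ {x} → TwoVal x → Nec x × Imp x
twoVal⇒Nec×Imp (here refl)         = tt , tt
twoVal⇒Nec×Imp (there (here refl)) = tt , tt

twoVal⊎Pos⊎PNe : ∀ x → TwoVal x ⊎ Pos x ⊎ PNe x
twoVal⊎Pos⊎PNe FF = inj₂ (inj₂ tt)
twoVal⊎Pos⊎PNe ff = inj₂ (inj₁ tt)
twoVal⊎Pos⊎PNe f₂ = inj₁ (here refl)
twoVal⊎Pos⊎PNe f₃ = inj₂ (inj₁ tt)
twoVal⊎Pos⊎PNe t₃ = inj₂ (inj₂ tt)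
twoVal⊎Pos⊎PNe t₂ = inj₁ (there (here refl))
twoVal⊎Pos⊎PNe tt = inj₂ (inj₁ tt)
twoVal⊎Pos⊎PNe TT = inj₂ (inj₁ tt)

des⇒topVal⊎PNe : ∀ {x} → Des x → TopVal x ⊎ PNe x
des⇒topVal⊎PNe {t₃} _ = inj₂ tt
des⇒topVal⊎PNe {t₂} _ = inj₁ (there (here refl))
des⇒topVal⊎PNe {tt} _ = inj₂ tt
des⇒topVal⊎PNe {TT} _ = inj₁ (here refl)

module _ {L : Logic} (M : Model L) where
  open Model M

  twoVal⇒no-successor : ∀ {v w} β → TwoVal (v β) → ¬ R v w
  twoVal⇒no-successor {v} {w} β two r =
    let nec , imp = twoVal⇒Nec×Imp two in kI v w β r imp (kN v w β r nec)

  twoVal-everywhere : ∀ {v} → Π v → ∀ β γ → TwoVal (v β) → TwoVal (v γ)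
  twoVal-everywhere {v} Πv β γ two with twoVal⊎Pos⊎PNe (v γ)
  ... | inj₁ two′ = two′
  ... | inj₂ (inj₁ pos) =
    let _ , _ , r , _ = preP v γ Πv pos in ⊥-elim (twoVal⇒no-successor β two r)
  ... | inj₂ (inj₂ pne) =
    let _ , _ , r , _ = prePN v γ Πv pne in ⊥-elim (twoVal⇒no-successor β two r)

  Π⇒Lev : ∀ n {v} → Π v → Lev L n v
  Π⇒Lev zero    {v} Πv = Π-val v Πv , twoVal-everywhere Πv
  Π⇒Lev (suc n) {v} Πv = Π⇒Lev n Πv , topVal
    where
    topVal : ∀ β → (∀ w → Lev L n w → Des (w β)) → TopVal (v β)
    topVal β desₙ with des⇒topVal⊎PNe (desₙ v (Π⇒Lev n Πv))
    ... | inj₁ top = top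
    ... | inj₂ pne =
      let w , Πw , _ , ¬des = prePN v β Πv pne in ⊥-elim (¬des (desₙ w (Π⇒Lev n Πw)))

lemma5 : (L : Logic) (v : For → TV) → PartialLevelVal L v → (n : ℕ) → Lev L n v
lemma5 L v (M , Πv) n = Π⇒Lev M n Πv
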